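{- Let $m\ge3$, $n\geq 2$ and $2\leq l\leq n-1$. Then $\chi^b_{(B(m,n),\sigma_l)}(\lambda)=\gamma_m^{n-l}\chi^b_{B^{uv}(m,l)}(\lambda)$, where $\gamma_m=\frac{(\lambda-1)^{m-1}-(-1)^{m-1}}{\lambda}$.
   Context: The book graph $B(m,n)$ has vertices $\{u,v\}\cup\{u_j^i:1\le i\le n,1\le j\le m-2\}$ and consists of the $n$ cycles $uu_1^i\cdots u_{m-2}^ivu$ sharing the edge $uv$. For $1\le l\le n$, $\sigma_l=\{uu_1^1,\ldots,uu_1^l\}$ is the set of negative edges of $(B(m,n),\sigma_l)$; $B^{uv}(m,l)$ is the signed graph on $B(m,l)$ whose only negative edge is $uv$. A zero-free coloring in $2k$ signed colors is a map $c:V\to\{ -k,\ldots,-1,1,\ldots,k\}$, proper if $c(x)\ne\sigma(e)c(y)$ for every edge $e=xy$; the zero-free chromatic polynomial is the polynomial whose value at $\lambda=2k$ counts proper zero-free colorings. -}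

module Defs where

open import Data.Bool using (Bool; true; false; if_then_else_)
open import Data.Nat as ℕ using (ℕ; zero; suc; _<ᵇ_)
open import Data.Fin using (Fin; zero; suc; toℕ; combine; _↑ʳ_)
open import Data.Fin.Base using (Fin)
open import Data.Integer as ℤ using (ℤ; +_; -[1+_]; -_; _-_; _^_)
open import Data.Integer.DivMod using (_/_)
open import Data.List using (List; []; _∷_; [_]; map; concatMap; length; filter; _++_; upTo; allFin)
open import Data.List.Relation.Unary.All using (All; all?)
open import Data.Vec using (Vec; []; _∷_; lookup)
open import Data.Product using (_×_; _,_)
open import Relation.Binary.PropositionalEquality using (_≢_)
open import Relation.Nullary using (Dec; ¬?)
open import Function using (_∘_)

-- Signed graphs on vertex set Fin nV.  An edge is (x , y , neg) where
-- neg = true means the edge is negative (sign -1), false positive.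

Edge : ℕ → Set
Edge N = Fin N × Fin N × Bool

record SignedGraph : Set where
  constructor mkSG
  field
    nV    : ℕ
    edges : List (Edge nV)
open SignedGraph public

applySign : Bool → ℤ → ℤ
applySign true  z = - z
applySign false z = z

signedColours : ℕ → List ℤ
signedColours k = map (λ j → + suc j) (upTo k) ++ map (λ j → -[1+ j ]) (upTo k)

allColourings : List ℤ → (N : ℕ) → List (Vec ℤ N)
allColourings cs zero    = [ [] ]
allColourings cs (suc N) = concatMap (λ c → map (c ∷_) (allColourings cs N)) cs

ProperEdge : ∀ {N} → Vec ℤ N → Edge N → Set
ProperEdge c (x , y , s) = lookup c x ≢ applySign s (lookup c y)

Proper : (G : SignedGraph) → Vec ℤ (nV G) → Set
Proper G c = All (ProperEdge c) (edges G)

proper? : (G : SignedGraph) → (c : Vec ℤ (nV G)) → Dec (Proper G c)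
proper? G c = all? (λ { (x , y , s) → ¬? (lookup c x ℤ.≟ applySign s (lookup c y)) }) (edges G)

-- number of proper zero-free colourings in 2k signed colours,
-- i.e. the zero-free chromatic polynomial evaluated at λ = 2k
zfCount : SignedGraph → ℕ → ℕ
zfCount G k = length (filter (proper? G) (allColourings (signedColours k) (nV G)))

-- Book graph B(m,n).  With p = m - 2, vertices are Fin (2 + n * p):
-- u = 0, v = 1, u^i_j = 2 + combine i j  (i : Fin n, j : Fin p, 0-based).

bookV : ℕ → ℕ → ℕ
bookV m n = 2 ℕ.+ n ℕ.* (m ℕ.∸ 2)

vu : ∀ {N} → Fin (2 ℕ.+ N)
vu = zero

vv : ∀ {N} → Fin (2 ℕ.+ N)
vv = suc zero

inner : ∀ {n p} → Fin n → Fin p → Fin (2 ℕ.+ n ℕ.* p)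
inner i j = 2 ↑ʳ combine i j

path : ∀ {N} (p : ℕ) → (Fin p → Fin N) → Fin N → Fin N → Bool → List (Edge N)
path zero    f a b s = [ (a , b , s) ]
path (suc p) f a b s = (a , f zero , s) ∷ path p (f ∘ suc) (f zero) b false

-- the i-th page: cycle u u^i_1 ... u^i_{m-2} v (closed by the shared edge uv);
-- negUU decides whether the edge u u^i_1 is negative
page : (m n : ℕ) → Bool → Fin n → List (Edge (bookV m n))
page m n neg i = path (m ℕ.∸ 2) (inner i) vu vv neg

-- (B(m,n), σ_l): negative edges exactly u u^i_1 for 1 ≤ i ≤ l
bookσ : (m n l : ℕ) → SignedGraph
bookσ m n l = mkSG (bookV m n)
  ((vu , vv , false) ∷ concatMap (λ i → page m n (toℕ i <ᵇ l) i) (allFin n))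

bookUV : (m l : ℕ) → SignedGraph
bookUV m l = mkSG (bookV m l)
  ((vu , vv , true) ∷ concatMap (page m l false) (allFin l))

-- γ_m(λ) = ((λ-1)^(m-1) - (-1)^(m-1)) / λ   (exact division, λ ≠ 0)
γ : (m : ℕ) (lam : ℤ) → .{{ℤ.NonZero lam}} → ℤ
γ m lam = ((lam - + 1) ^ (m ℕ.∸ 1) - (- + 1) ^ (m ℕ.∸ 1)) / lam

-- Fix the colours a of u and b of v.  The pages are then coloured independently, and a page whose
-- first edge is negative is counted like a positive page with a replaced by -a.  A positive page
-- admits a number of colourings that depends only on whether a = b; for a ≠ b, multiplied by λ, it
-- is (λ-1)^(m-1) - (-1)^(m-1), so it is γ_m.  Hence the n - l positive pages of (B(m,n),σ_l) contribute
-- the factor γ_m^(n-l), and what remains is the count for (B(m,l),σ_l), which switching at u turns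
-- into the count for B^{uv}(m,l).

module Submission where

open import Defs
open import Data.Bool using (Bool; true; false; if_then_else_)
open import Data.Empty using (⊥-elim)
open import Data.Fin using (Fin; zero; suc; toℕ; combine)
open import Data.Integer using (ℤ; +_; -[1+_]; -_; _-_)
  renaming (_+_ to _+ℤ_; _*_ to _*ℤ_; _^_ to _^ℤ_)
import Data.Integer.Properties as ℤ
open import Data.Integer.DivMod using (_/_; div-pos-is-/ℕ)
open import Data.Integer.Tactic.RingSolver using () renaming (solve-∀ to solve-∀ℤ)
open import Data.List using (List; []; _∷_; _++_; map; concatMap; length; filter; upTo; allFin; tabulate)
import Data.List.Properties as List
open import Data.List.Membership.Propositional using (_∈_)
open import Data.List.Membership.Propositional.Properties using (∈-map⁻)
open import Data.List.Relation.Unary.All as All using (All; all?; _∷_)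
open import Data.List.Relation.Unary.AllPairs using (_∷_)
open import Data.List.Relation.Unary.Any using (here; there)
open import Data.List.Relation.Unary.Unique.Propositional using (Unique)
import Data.List.Relation.Unary.Unique.Propositional.Properties as Unique
open import Data.Nat using (ℕ; zero; suc; _+_; _*_; _^_; _∸_; _≤_; _<ᵇ_; s≤s)
import Data.Nat as ℕ using (NonZero; _/_)
open import Data.Nat.DivMod using (m*n/n≡m)
import Data.Nat.Properties as ℕ
open import Data.Nat.Tactic.RingSolver using (solve-∀)
open import Data.Product using (_×_; _,_; proj₁; proj₂)
open import Data.Vec as Vec using (Vec; []; _∷_; lookup)
import Data.Vec.Properties as Vec
open import Function using (_∘_; id)
open import Relation.Binary.Definitions using (DecidableEquality)
open import Relation.Binary.PropositionalEquality
open import Relation.Nullary using (Dec; yes; no; does; ¬_; ¬?)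
open import Relation.Unary using (Decidable)

open ≡-Reasoning

indicator : ∀ {p} {P : Set p} → Dec P → ℕ
indicator P? = if does P? then 1 else 0

indicator-cong : ∀ {p q} {P : Set p} {Q : Set q} → (P → Q) → (Q → P) →
                 (P? : Dec P) (Q? : Dec Q) → indicator P? ≡ indicator Q?
indicator-cong P→Q Q→P (yes _) (yes _) = refl
indicator-cong P→Q Q→P (no _)  (no _)  = refl
indicator-cong P→Q Q→P (yes p) (no ¬q) = ⊥-elim (¬q (P→Q p))
indicator-cong P→Q Q→P (no ¬p) (yes q) = ⊥-elim (¬p (Q→P q))

module _ {A : Set} where

  ∑ ∏ : List A → (A → ℕ) → ℕ
  ∑ []       f = 0
  ∑ (x ∷ xs) f = f x + ∑ xs f
  ∏ []       f = 1
  ∏ (x ∷ xs) f = f x * ∏ xs f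

  infix 5 ∑
  syntax ∑ xs (λ x → e) = ∑[ x ∈ xs ] e

  ∑-++ : ∀ xs ys (f : A → ℕ) → ∑ (xs ++ ys) f ≡ ∑ xs f + ∑ ys f
  ∑-++ []       ys f = refl
  ∑-++ (x ∷ xs) ys f = trans (cong (_+_ (f x)) (∑-++ xs ys f)) (sym (ℕ.+-assoc (f x) _ _))

  ∏-++ : ∀ xs ys (f : A → ℕ) → ∏ (xs ++ ys) f ≡ ∏ xs f * ∏ ys f
  ∏-++ []       ys f = sym (ℕ.*-identityˡ _)
  ∏-++ (x ∷ xs) ys f = trans (cong (f x *_) (∏-++ xs ys f)) (sym (ℕ.*-assoc (f x) _ _))

  ∑-cong : ∀ xs {f g : A → ℕ} → (∀ x → f x ≡ g x) → ∑ xs f ≡ ∑ xs g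
  ∑-cong []       f≗g = refl
  ∑-cong (x ∷ xs) f≗g = cong₂ _+_ (f≗g x) (∑-cong xs f≗g)

  ∑-cong-∈ : ∀ xs {f g : A → ℕ} → (∀ {x} → x ∈ xs → f x ≡ g x) → ∑ xs f ≡ ∑ xs g
  ∑-cong-∈ []       f≗g = refl
  ∑-cong-∈ (x ∷ xs) f≗g = cong₂ _+_ (f≗g (here refl)) (∑-cong-∈ xs (f≗g ∘ there))

  ∏-cong : ∀ xs {f g : A → ℕ} → (∀ x → f x ≡ g x) → ∏ xs f ≡ ∏ xs g
  ∏-cong []       f≗g = refl
  ∏-cong (x ∷ xs) f≗g = cong₂ _*_ (f≗g x) (∏-cong xs f≗g)

  *-distribˡ-∑ : ∀ c xs (f : A → ℕ) → c * ∑ xs f ≡ ∑[ x ∈ xs ] c * f x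
  *-distribˡ-∑ c []       f = ℕ.*-zeroʳ c
  *-distribˡ-∑ c (x ∷ xs) f = trans (ℕ.*-distribˡ-+ c (f x) _) (cong (_+_ (c * f x)) (*-distribˡ-∑ c xs f))

  *-distribʳ-∑ : ∀ c xs (f : A → ℕ) → ∑ xs f * c ≡ ∑[ x ∈ xs ] f x * c
  *-distribʳ-∑ c xs f = begin
    ∑ xs f * c             ≡⟨ ℕ.*-comm (∑ xs f) c ⟩
    c * ∑ xs f             ≡⟨ *-distribˡ-∑ c xs f ⟩
    (∑[ x ∈ xs ] c * f x)  ≡⟨ ∑-cong xs (λ x → ℕ.*-comm c (f x)) ⟩
    (∑[ x ∈ xs ] f x * c)  ∎

  ∑-const : ∀ xs c → (∑[ x ∈ xs ] c) ≡ length xs * c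
  ∑-const []       c = refl
  ∑-const (x ∷ xs) c = cong (_+_ c) (∑-const xs c)

  length-filter : ∀ {P : A → Set} (P? : Decidable P) xs →
                  length (filter P? xs) ≡ ∑[ x ∈ xs ] indicator (P? x)
  length-filter P? []       = refl
  length-filter P? (x ∷ xs) with does (P? x)
  ... | true  = cong suc (length-filter P? xs)
  ... | false = length-filter P? xs

  indicator-all? : ∀ {P : A → Set} (P? : Decidable P) xs →
                   indicator (all? P? xs) ≡ ∏ xs (indicator ∘ P?)
  indicator-all? P? []       = refl
  indicator-all? P? (x ∷ xs) with does (P? x)
  ... | true  = trans (indicator-all? P? xs) (sym (ℕ.*-identityˡ _))
  ... | false = refl

module _ {A B : Set} where

  ∑-map : ∀ (g : A → B) xs (f : B → ℕ) → ∑ (map g xs) f ≡ ∑ xs (f ∘ g)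
  ∑-map g []       f = refl
  ∑-map g (x ∷ xs) f = cong (_+_ (f (g x))) (∑-map g xs f)

  ∑-concatMap : ∀ (g : A → List B) xs (f : B → ℕ) → ∑ (concatMap g xs) f ≡ ∑[ x ∈ xs ] ∑ (g x) f
  ∑-concatMap g []       f = refl
  ∑-concatMap g (x ∷ xs) f = trans (∑-++ (g x) _ f) (cong (_+_ (∑ (g x) f)) (∑-concatMap g xs f))

  ∏-concatMap : ∀ (g : A → List B) xs (f : B → ℕ) → ∏ (concatMap g xs) f ≡ ∏ xs (λ x → ∏ (g x) f)
  ∏-concatMap g []       f = refl
  ∏-concatMap g (x ∷ xs) f = trans (∏-++ (g x) _ f) (cong (∏ (g x) f *_) (∏-concatMap g xs f))

∏Fin : ∀ n → (Fin n → ℕ) → ℕ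
∏Fin zero    f = 1
∏Fin (suc n) f = f zero * ∏Fin n (f ∘ suc)

∏Fin-cong : ∀ n {f g : Fin n → ℕ} → (∀ i → f i ≡ g i) → ∏Fin n f ≡ ∏Fin n g
∏Fin-cong zero    f≗g = refl
∏Fin-cong (suc n) f≗g = cong₂ _*_ (f≗g zero) (∏Fin-cong n (f≗g ∘ suc))

∏Fin-const : ∀ n c → ∏Fin n (λ _ → c) ≡ c ^ n
∏Fin-const zero    c = refl
∏Fin-const (suc n) c = cong (c *_) (∏Fin-const n c)

∏-tabulate : ∀ {A : Set} n (g : Fin n → A) (f : A → ℕ) → ∏ (tabulate g) f ≡ ∏Fin n (f ∘ g)
∏-tabulate zero    g f = refl
∏-tabulate (suc n) g f = cong (f (g zero) *_) (∏-tabulate n (g ∘ suc) f)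

∏Fin-threshold : ∀ (g : Bool → ℕ) n l → l ≤ n →
                 ∏Fin n (λ i → g (toℕ i <ᵇ l)) ≡ g true ^ l * g false ^ (n ∸ l)
∏Fin-threshold g n       zero    _         = trans (∏Fin-const n (g false)) (sym (ℕ.*-identityˡ _))
∏Fin-threshold g (suc n) (suc l) (s≤s l≤n) =
  trans (cong (g true *_) (∏Fin-threshold g n l l≤n)) (sym (ℕ.*-assoc (g true) _ _))

module Distinctness {A : Set} (_≟_ : DecidableEquality A) where

  distinct : A → A → ℕ
  distinct x y = indicator (¬? (x ≟ y))

  distinct-refl : ∀ x → distinct x x ≡ 0
  distinct-refl x with x ≟ x
  ... | yes _   = refl
  ... | no  x≢x = ⊥-elim (x≢x refl)

  distinct-≢ : ∀ {x y} → x ≢ y → distinct x y ≡ 1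
  distinct-≢ {x} {y} x≢y with x ≟ y
  ... | yes x≡y = ⊥-elim (x≢y x≡y)
  ... | no  _   = refl

  distinct-*-cong : ∀ {x y} m {n} → (x ≢ y → m ≡ n) → distinct x y * m ≡ distinct x y * n
  distinct-*-cong {x} {y} m x≢y⇒m≡n with x ≟ y
  ... | yes _   = refl
  ... | no  x≢y = cong (1 *_) (x≢y⇒m≡n x≢y)

  ∑-distinct-∉ : ∀ {x} ys (f : A → ℕ) → All (x ≢_) ys → ∑[ y ∈ ys ] distinct x y * f y ≡ ∑ ys f
  ∑-distinct-∉ []       f _            = refl
  ∑-distinct-∉ (y ∷ ys) f (x≢y ∷ x∉ys) =
    cong₂ _+_ (trans (cong (_* f y) (distinct-≢ x≢y)) (ℕ.*-identityˡ (f y))) (∑-distinct-∉ ys f x∉ys)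

  ∑-distinct : ∀ {x} ys (f : A → ℕ) → Unique ys → x ∈ ys →
               (∑[ y ∈ ys ] distinct x y * f y) + f x ≡ ∑ ys f
  ∑-distinct {x} (x ∷ ys) f (x∉ys ∷ _) (here refl) = begin
    distinct x x * f x + (∑[ y ∈ ys ] distinct x y * f y) + f x
      ≡⟨ cong (λ d → d * f x + (∑[ y ∈ ys ] distinct x y * f y) + f x) (distinct-refl x) ⟩
    (∑[ y ∈ ys ] distinct x y * f y) + f x
      ≡⟨ cong (_+ f x) (∑-distinct-∉ ys f x∉ys) ⟩
    ∑ ys f + f x
      ≡⟨ ℕ.+-comm (∑ ys f) (f x) ⟩
    f x + ∑ ys f ∎
  ∑-distinct {x} (y ∷ ys) f (y∉ys ∷ ys-unique) (there x∈ys) = begin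
    distinct x y * f y + (∑[ z ∈ ys ] distinct x z * f z) + f x
      ≡⟨ cong (λ d → d * f y + (∑[ z ∈ ys ] distinct x z * f z) + f x)
              (distinct-≢ (≢-sym (All.lookup y∉ys x∈ys))) ⟩
    1 * f y + (∑[ z ∈ ys ] distinct x z * f z) + f x
      ≡⟨ ℕ.+-assoc (1 * f y) _ (f x) ⟩
    1 * f y + ((∑[ z ∈ ys ] distinct x z * f z) + f x)
      ≡⟨ cong₂ _+_ (ℕ.*-identityˡ (f y)) (∑-distinct ys f ys-unique x∈ys) ⟩
    f y + ∑ ys f ∎

  ∑-constExcept : ∀ {x} ys (f : A → ℕ) c → Unique ys → x ∈ ys →
                  (∀ {y} → y ∈ ys → y ≢ x → f y ≡ c) → ∑ ys f + c ≡ length ys * c + f x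
  ∑-constExcept {x} (x ∷ ys) f c (x∉ys ∷ _) (here refl) f≡c = begin
    f x + ∑ ys f + c          ≡⟨ cong (λ s → f x + s + c) ∑ys≡ ⟩
    f x + length ys * c + c   ≡⟨ swap (f x) (length ys * c) c ⟩
    c + length ys * c + f x   ∎
    where
    ∑ys≡ : ∑ ys f ≡ length ys * c
    ∑ys≡ = trans (∑-cong-∈ ys (λ y∈ys → f≡c (there y∈ys) (≢-sym (All.lookup x∉ys y∈ys))))
                 (∑-const ys c)
    swap : ∀ a b c → a + b + c ≡ c + b + a
    swap = solve-∀
  ∑-constExcept {x} (y ∷ ys) f c (y∉ys ∷ ys-unique) (there x∈ys) f≡c = begin
    f y + ∑ ys f + c          ≡⟨ ℕ.+-assoc (f y) _ c ⟩
    f y + (∑ ys f + c)        ≡⟨ cong₂ _+_ (f≡c (here refl) (All.lookup y∉ys x∈ys))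
                                           (∑-constExcept ys f c ys-unique x∈ys (f≡c ∘ there)) ⟩
    c + (length ys * c + f x) ≡⟨ ℕ.+-assoc c _ (f x) ⟨
    c + length ys * c + f x   ∎

open Distinctness ℤ._≟_

distinct-neg : ∀ x y → distinct (- x) (- y) ≡ distinct x y
distinct-neg x y = indicator-cong (λ -x≢-y x≡y → -x≢-y (cong -_ x≡y))
                                  (λ x≢y -x≡-y → x≢y (ℤ.neg-injective -x≡-y))
                                  (¬? (- x ℤ.≟ - y)) (¬? (x ℤ.≟ y))

distinct-negʳ : ∀ x y → distinct x (- y) ≡ distinct (- x) y
distinct-negʳ x y = indicator-cong
  (λ x≢-y -x≡y → x≢-y (trans (sym (ℤ.neg-involutive x)) (cong -_ -x≡y)))
  (λ -x≢y x≡-y → -x≢y (trans (cong -_ x≡-y) (ℤ.neg-involutive y)))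
  (¬? (x ℤ.≟ - y)) (¬? (- x ℤ.≟ y))

edgeIndicator : ∀ {N} → Vec ℤ N → Edge N → ℕ
edgeIndicator c (x , y , s) = distinct (lookup c x) (applySign s (lookup c y))

indicator-proper? : ∀ G c → indicator (proper? G c) ≡ ∏ (edges G) (edgeIndicator c)
indicator-proper? G c = trans (indicator-all? _ (edges G)) (∏-cong (edges G) (λ { (x , y , s) → refl }))

pathIndicator : ∀ p → Bool → ℤ → Vec ℤ p → ℤ → ℕ
pathIndicator zero    s a []       b = distinct a (applySign s b)
pathIndicator (suc p) s a (w ∷ ws) b = distinct a (applySign s w) * pathIndicator p false w ws b

∏-path : ∀ {N} (c : Vec ℤ N) p (f : Fin p → Fin N) a b s →
         ∏ (path p f a b s) (edgeIndicator c)
           ≡ pathIndicator p s (lookup c a) (Vec.tabulate (lookup c ∘ f)) (lookup c b)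
∏-path c zero    f a b s = ℕ.*-identityʳ _
∏-path c (suc p) f a b s = cong (edgeIndicator c (a , f zero , s) *_) (∏-path c p (f ∘ suc) (f zero) b false)

pathIndicator-neg : ∀ p a v b → pathIndicator p true a v b ≡ pathIndicator p false (- a) v b
pathIndicator-neg zero    a []       b = distinct-negʳ a b
pathIndicator-neg (suc p) a (w ∷ ws) b = cong (_* pathIndicator p false w ws b) (distinct-negʳ a w)

-- bookσ m n l and bookUV m l are definitionally signed books with p = m ∸ 2.
signedBook : (n p : ℕ) → Bool → (Fin n → Bool) → SignedGraph
signedBook n p s sg =
  mkSG (2 + n * p) ((vu , vv , s) ∷ concatMap (λ i → path p (inner i) vu vv (sg i)) (allFin n))

-- The numbers of proper colourings, with 2 + t colours, of the p inner vertices of a positive path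
-- whose end colours are distinct, resp. equal.
pathCount≢ pathCount≡ : ℕ → ℕ → ℕ
pathCount≢ t zero    = 1
pathCount≢ t (suc p) = t * pathCount≢ t p + pathCount≡ t p
pathCount≡ t zero    = 0
pathCount≡ t (suc p) = suc t * pathCount≢ t p

module Colourings (C : List ℤ) where

  ∑ᶜ : ∀ N → (Vec ℤ N → ℕ) → ℕ
  ∑ᶜ N F = ∑ (allColourings C N) F

  ∑ᶜ-cong : ∀ N {F G : Vec ℤ N → ℕ} → (∀ v → F v ≡ G v) → ∑ᶜ N F ≡ ∑ᶜ N G
  ∑ᶜ-cong N = ∑-cong (allColourings C N)

  ∑ᶜ-suc : ∀ N F → ∑ᶜ (suc N) F ≡ ∑[ a ∈ C ] ∑ᶜ N (λ v → F (a ∷ v))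
  ∑ᶜ-suc N F = trans (∑-concatMap (λ a → map (a ∷_) (allColourings C N)) C F)
                     (∑-cong C (λ a → ∑-map (a ∷_) (allColourings C N) F))

  ∑ᶜ-++ : ∀ p N F → ∑ᶜ (p + N) F ≡ ∑ᶜ p (λ x → ∑ᶜ N (λ y → F (x Vec.++ y)))
  ∑ᶜ-++ zero    N F = sym (ℕ.+-identityʳ _)
  ∑ᶜ-++ (suc p) N F = begin
    ∑ᶜ (suc p + N) F
      ≡⟨ ∑ᶜ-suc (p + N) F ⟩
    ∑[ a ∈ C ] ∑ᶜ (p + N) (λ v → F (a ∷ v))
      ≡⟨ ∑-cong C (λ a → ∑ᶜ-++ p N (λ v → F (a ∷ v))) ⟩
    ∑[ a ∈ C ] ∑ᶜ p (λ x → ∑ᶜ N (λ y → F (a ∷ x Vec.++ y)))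
      ≡⟨ ∑ᶜ-suc p (λ x → ∑ᶜ N (λ y → F (x Vec.++ y))) ⟨
    ∑ᶜ (suc p) (λ x → ∑ᶜ N (λ y → F (x Vec.++ y))) ∎

  slice : ∀ {n p} → Fin n → Vec ℤ (n * p) → Vec ℤ p
  slice i w = Vec.tabulate (λ j → lookup w (combine i j))

  slice-zero : ∀ {n p} (x : Vec ℤ p) (y : Vec ℤ (n * p)) → slice {suc n} zero (x Vec.++ y) ≡ x
  slice-zero x y = trans (Vec.tabulate-cong (Vec.lookup-++ˡ x y)) (Vec.tabulate∘lookup x)

  slice-suc : ∀ {n p} (i : Fin n) (x : Vec ℤ p) (y : Vec ℤ (n * p)) →
              slice {suc n} (suc i) (x Vec.++ y) ≡ slice i y
  slice-suc i x y = Vec.tabulate-cong (λ j → Vec.lookup-++ʳ x y (combine i j))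

  ∑ᶜ-∏Fin-slices : ∀ n p (F : Fin n → Vec ℤ p → ℕ) →
                   ∑ᶜ (n * p) (λ w → ∏Fin n (λ i → F i (slice i w))) ≡ ∏Fin n (λ i → ∑ᶜ p (F i))
  ∑ᶜ-∏Fin-slices zero    p F = refl
  ∑ᶜ-∏Fin-slices (suc n) p F = begin
    ∑ᶜ (p + n * p) (λ w → ∏Fin (suc n) (λ i → F i (slice i w)))
      ≡⟨ ∑ᶜ-++ p (n * p) _ ⟩
    ∑ᶜ p (λ x → ∑ᶜ (n * p) (λ y → F zero (slice {suc n} zero (x Vec.++ y))
                                   * ∏Fin n (λ i → F (suc i) (slice {suc n} (suc i) (x Vec.++ y)))))
      ≡⟨ ∑ᶜ-cong p (λ x → ∑ᶜ-cong (n * p) (λ y →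
           cong₂ _*_ (cong (F zero) (slice-zero {n} x y))
                     (∏Fin-cong n (λ i → cong (F (suc i)) (slice-suc i x y))))) ⟩
    ∑ᶜ p (λ x → ∑ᶜ (n * p) (λ y → F zero x * ∏Fin n (λ i → F (suc i) (slice i y))))
      ≡⟨ ∑ᶜ-cong p (λ x → *-distribˡ-∑ (F zero x) (allColourings C (n * p)) _) ⟨
    ∑ᶜ p (λ x → F zero x * ∑ᶜ (n * p) (λ y → ∏Fin n (λ i → F (suc i) (slice i y))))
      ≡⟨ ∑ᶜ-cong p (λ x → cong (F zero x *_) (∑ᶜ-∏Fin-slices n p (F ∘ suc))) ⟩
    ∑ᶜ p (λ x → F zero x * ∏Fin n (λ i → ∑ᶜ p (F (suc i))))
      ≡⟨ *-distribʳ-∑ (∏Fin n (λ i → ∑ᶜ p (F (suc i)))) (allColourings C p) (F zero) ⟨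
    ∑ᶜ p (F zero) * ∏Fin n (λ i → ∑ᶜ p (F (suc i))) ∎

  pathColourings : ∀ p → Bool → ℤ → ℤ → ℕ
  pathColourings p s a b = ∑ᶜ p (λ v → pathIndicator p s a v b)

  pathColourings-neg : ∀ p a b → pathColourings p true a b ≡ pathColourings p false (- a) b
  pathColourings-neg p a b = ∑ᶜ-cong p (λ v → pathIndicator-neg p a v b)

  pathColourings-suc : ∀ p a b →
    pathColourings (suc p) false a b ≡ ∑[ w ∈ C ] distinct a w * pathColourings p false w b
  pathColourings-suc p a b =
    trans (∑ᶜ-suc p _) (∑-cong C (λ w → sym (*-distribˡ-∑ (distinct a w) (allColourings C p) _)))

  properColourings-signedBook : ∀ n p s sg →
    length (filter (proper? (signedBook n p s sg)) (allColourings C (2 + n * p)))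
      ≡ ∑[ a ∈ C ] ∑[ b ∈ C ] distinct a (applySign s b) * ∏Fin n (λ i → pathColourings p (sg i) a b)
  properColourings-signedBook n p s sg = begin
    length (filter (proper? G) (allColourings C (2 + n * p)))
      ≡⟨ length-filter (proper? G) (allColourings C (2 + n * p)) ⟩
    ∑ᶜ (2 + n * p) (indicator ∘ proper? G)
      ≡⟨ trans (∑ᶜ-suc (suc (n * p)) _) (∑-cong C (λ a → ∑ᶜ-suc (n * p) _)) ⟩
    ∑[ a ∈ C ] ∑[ b ∈ C ] ∑ᶜ (n * p) (λ w → indicator (proper? G (a ∷ b ∷ w)))
      ≡⟨ ∑-cong C (λ a → ∑-cong C (λ b → ∑ᶜ-cong (n * p) (indicator-proper?-signedBook a b))) ⟩
    ∑[ a ∈ C ] ∑[ b ∈ C ] ∑ᶜ (n * p) (λ w → uv a b * ∏Fin n (λ i → pathIndicator p (sg i) a (slice i w) b))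
      ≡⟨ ∑-cong C (λ a → ∑-cong C (λ b → begin
           ∑ᶜ (n * p) (λ w → uv a b * ∏Fin n (λ i → pathIndicator p (sg i) a (slice i w) b))
             ≡⟨ *-distribˡ-∑ (uv a b) (allColourings C (n * p)) _ ⟨
           uv a b * ∑ᶜ (n * p) (λ w → ∏Fin n (λ i → pathIndicator p (sg i) a (slice i w) b))
             ≡⟨ cong (uv a b *_) (∑ᶜ-∏Fin-slices n p (λ i v → pathIndicator p (sg i) a v b)) ⟩
           uv a b * ∏Fin n (λ i → pathColourings p (sg i) a b) ∎)) ⟩
    ∑[ a ∈ C ] ∑[ b ∈ C ] uv a b * ∏Fin n (λ i → pathColourings p (sg i) a b) ∎
    where
    G = signedBook n p s sg
    uv : ℤ → ℤ → ℕ
    uv a b = distinct a (applySign s b)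
    indicator-proper?-signedBook : ∀ a b w → indicator (proper? G (a ∷ b ∷ w))
      ≡ uv a b * ∏Fin n (λ i → pathIndicator p (sg i) a (slice i w) b)
    indicator-proper?-signedBook a b w = begin
      indicator (proper? G (a ∷ b ∷ w))
        ≡⟨ indicator-proper? G (a ∷ b ∷ w) ⟩
      uv a b * ∏ (concatMap (λ i → path p (inner i) vu vv (sg i)) (allFin n)) (edgeIndicator (a ∷ b ∷ w))
        ≡⟨ cong (uv a b *_) (trans (∏-concatMap _ (allFin n) _) (∏-tabulate n id _)) ⟩
      uv a b * ∏Fin n (λ i → ∏ (path p (inner i) vu vv (sg i)) (edgeIndicator (a ∷ b ∷ w)))
        ≡⟨ cong (uv a b *_) (∏Fin-cong n (λ i → ∏-path (a ∷ b ∷ w) p (inner i) vu vv (sg i))) ⟩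
      uv a b * ∏Fin n (λ i → pathIndicator p (sg i) a (slice i w) b) ∎

  module _ (C-unique : Unique C) {t} (length-C : length C ≡ 2 + t) where

    pathColourings-recurrence : ∀ p {a b} → a ∈ C → b ∈ C →
      pathColourings (suc p) false a b + pathColourings p false a b + pathCount≢ t p
        ≡ (2 + t) * pathCount≢ t p + pathCount≡ t p
    pathColourings-≢ : ∀ p {a b} → a ∈ C → b ∈ C → a ≢ b → pathColourings p false a b ≡ pathCount≢ t p
    pathColourings-≡ : ∀ p {a} → a ∈ C → pathColourings p false a a ≡ pathCount≡ t p

    pathColourings-recurrence p {a} {b} a∈C b∈C = begin
      Q (suc p) a b + Q p a b + D
        ≡⟨ cong (λ x → x + Q p a b + D) (pathColourings-suc p a b) ⟩
      (∑[ w ∈ C ] distinct a w * Q p w b) + Q p a b + D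
        ≡⟨ cong (_+ D) (∑-distinct C (λ w → Q p w b) C-unique a∈C) ⟩
      (∑[ w ∈ C ] Q p w b) + D
        ≡⟨ ∑-constExcept C (λ w → Q p w b) D C-unique b∈C (λ w∈C → pathColourings-≢ p w∈C b∈C) ⟩
      length C * D + Q p b b
        ≡⟨ cong₂ (λ n e → n * D + e) length-C (pathColourings-≡ p b∈C) ⟩
      (2 + t) * D + pathCount≡ t p ∎
      where
      Q : ℕ → ℤ → ℤ → ℕ
      Q q = pathColourings q false
      D = pathCount≢ t p

    pathColourings-≢ zero    _   _   a≢b = trans (ℕ.+-identityʳ _) (distinct-≢ a≢b)
    pathColourings-≢ (suc p) {a} {b} a∈C b∈C a≢b = ℕ.+-cancelʳ-≡ (D + D) _ _ (begin
      Q′ + (D + D)              ≡⟨ ℕ.+-assoc Q′ D D ⟨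
      Q′ + D + D                ≡⟨ cong (λ x → Q′ + x + D) (pathColourings-≢ p a∈C b∈C a≢b) ⟨
      Q′ + pathColourings p false a b + D
                                ≡⟨ pathColourings-recurrence p a∈C b∈C ⟩
      (2 + t) * D + E           ≡⟨ rearrange t D E ⟩
      t * D + E + (D + D)       ∎)
      where
      Q′ = pathColourings (suc p) false a b
      D = pathCount≢ t p
      E = pathCount≡ t p
      rearrange : ∀ t d e → (2 + t) * d + e ≡ t * d + e + (d + d)
      rearrange = solve-∀

    pathColourings-≡ zero    {a} _   = trans (ℕ.+-identityʳ _) (distinct-refl a)
    pathColourings-≡ (suc p) {a} a∈C = ℕ.+-cancelʳ-≡ (E + D) _ _ (begin
      Q′ + (E + D)              ≡⟨ ℕ.+-assoc Q′ E D ⟨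
      Q′ + E + D                ≡⟨ cong (λ x → Q′ + x + D) (pathColourings-≡ p a∈C) ⟨
      Q′ + pathColourings p false a a + D
                                ≡⟨ pathColourings-recurrence p a∈C a∈C ⟩
      (2 + t) * D + E           ≡⟨ rearrange t D E ⟩
      suc t * D + (E + D)       ∎)
      where
      Q′ = pathColourings (suc p) false a a
      D = pathCount≢ t p
      E = pathCount≡ t p
      rearrange : ∀ t d e → (2 + t) * d + e ≡ suc t * d + (e + d)
      rearrange = solve-∀

pathCount-closedForm : ∀ t p →
  (+ 2 +ℤ + t) *ℤ + pathCount≢ t p ≡ (+ 1 +ℤ + t) ^ℤ suc p - (- + 1) ^ℤ suc p ×
  (+ 2 +ℤ + t) *ℤ + pathCount≡ t p ≡ (+ 1 +ℤ + t) ^ℤ suc p +ℤ (+ 1 +ℤ + t) *ℤ (- + 1) ^ℤ suc p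
pathCount-closedForm t zero    = base≢ (+ t) , base≡ (+ t)
  where
  base≢ : ∀ T → (+ 2 +ℤ T) *ℤ + 1 ≡ (+ 1 +ℤ T) *ℤ + 1 - (- + 1) *ℤ + 1
  base≢ = solve-∀ℤ
  base≡ : ∀ T → (+ 2 +ℤ T) *ℤ + 0 ≡ (+ 1 +ℤ T) *ℤ + 1 +ℤ (+ 1 +ℤ T) *ℤ ((- + 1) *ℤ + 1)
  base≡ = solve-∀ℤ
pathCount-closedForm t (suc p) = step≢ , step≡
  where
  T = + t
  X = (+ 1 +ℤ T) ^ℤ suc p
  S = (- + 1) ^ℤ suc p
  D = pathCount≢ t p
  E = pathCount≡ t p
  IH = pathCount-closedForm t p

  step≢ : (+ 2 +ℤ T) *ℤ + (t * D + E) ≡ (+ 1 +ℤ T) *ℤ X - (- + 1) *ℤ S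
  step≢ = begin
    (+ 2 +ℤ T) *ℤ + (t * D + E)
      ≡⟨ cong ((+ 2 +ℤ T) *ℤ_) (trans (ℤ.pos-+ (t * D) E) (cong (_+ℤ + E) (ℤ.pos-* t D))) ⟩
    (+ 2 +ℤ T) *ℤ (T *ℤ + D +ℤ + E)
      ≡⟨ expand T (+ D) (+ E) ⟩
    T *ℤ ((+ 2 +ℤ T) *ℤ + D) +ℤ (+ 2 +ℤ T) *ℤ + E
      ≡⟨ cong₂ (λ d e → T *ℤ d +ℤ e) (proj₁ IH) (proj₂ IH) ⟩
    T *ℤ (X - S) +ℤ (X +ℤ (+ 1 +ℤ T) *ℤ S)
      ≡⟨ collect T X S ⟩
    (+ 1 +ℤ T) *ℤ X - (- + 1) *ℤ S ∎
    where
    expand : ∀ T d e → (+ 2 +ℤ T) *ℤ (T *ℤ d +ℤ e) ≡ T *ℤ ((+ 2 +ℤ T) *ℤ d) +ℤ (+ 2 +ℤ T) *ℤ e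
    expand = solve-∀ℤ
    collect : ∀ T X S → T *ℤ (X - S) +ℤ (X +ℤ (+ 1 +ℤ T) *ℤ S) ≡ (+ 1 +ℤ T) *ℤ X - (- + 1) *ℤ S
    collect = solve-∀ℤ

  step≡ : (+ 2 +ℤ T) *ℤ + (suc t * D) ≡ (+ 1 +ℤ T) *ℤ X +ℤ (+ 1 +ℤ T) *ℤ ((- + 1) *ℤ S)
  step≡ = begin
    (+ 2 +ℤ T) *ℤ + (suc t * D)
      ≡⟨ cong ((+ 2 +ℤ T) *ℤ_) (ℤ.pos-* (suc t) D) ⟩
    (+ 2 +ℤ T) *ℤ ((+ 1 +ℤ T) *ℤ + D)
      ≡⟨ swap T (+ D) ⟩
    (+ 1 +ℤ T) *ℤ ((+ 2 +ℤ T) *ℤ + D)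
      ≡⟨ cong ((+ 1 +ℤ T) *ℤ_) (proj₁ IH) ⟩
    (+ 1 +ℤ T) *ℤ (X - S)
      ≡⟨ collect T X S ⟩
    (+ 1 +ℤ T) *ℤ X +ℤ (+ 1 +ℤ T) *ℤ ((- + 1) *ℤ S) ∎
    where
    swap : ∀ T d → (+ 2 +ℤ T) *ℤ ((+ 1 +ℤ T) *ℤ d) ≡ (+ 1 +ℤ T) *ℤ ((+ 2 +ℤ T) *ℤ d)
    swap = solve-∀ℤ
    collect : ∀ T X S → (+ 1 +ℤ T) *ℤ (X - S) ≡ (+ 1 +ℤ T) *ℤ X +ℤ (+ 1 +ℤ T) *ℤ ((- + 1) *ℤ S)
    collect = solve-∀ℤ

/-exact : ∀ {x} n d .{{_ : ℕ.NonZero n}} → x ≡ + n *ℤ + d → x / + n ≡ + d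
/-exact n d refl = begin
  + n *ℤ + d / + n   ≡⟨ cong (_/ + n) (ℤ.pos-* n d) ⟨
  + (n * d) / + n    ≡⟨ div-pos-is-/ℕ (+ (n * d)) n ⟩
  + (n * d ℕ./ n)    ≡⟨ cong (λ m → + (m ℕ./ n)) (ℕ.*-comm n d) ⟩
  + (d * n ℕ./ n)    ≡⟨ cong +_ (m*n/n≡m d n) ⟩
  + d                ∎

γ-pathCount : ∀ {m} t → 2 ≤ m → ∀ lam .{{_ : ℕ.NonZero lam}} → lam ≡ 2 + t →
              γ m (+ lam) ≡ + pathCount≢ t (m ∸ 2)
γ-pathCount {suc (suc q)} t (s≤s (s≤s _)) lam refl =
  /-exact (2 + t) (pathCount≢ t q) (sym (proj₁ (pathCount-closedForm t q)))

pos-^ : ∀ d r → + (d ^ r) ≡ (+ d) ^ℤ r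
pos-^ d zero    = refl
pos-^ d (suc r) = trans (ℤ.pos-* d (d ^ r)) (cong (+ d *ℤ_) (pos-^ d r))

length-signedColours : ∀ K → length (signedColours K) ≡ 2 * K
length-signedColours K = begin
  length (signedColours K)
    ≡⟨ List.length-++ (map _ (upTo K)) ⟩
  length (map _ (upTo K)) + length (map -[1+_] (upTo K))
    ≡⟨ cong₂ _+_ (length-map-upTo _) (length-map-upTo -[1+_]) ⟩
  K + K
    ≡⟨ cong (_+_ K) (ℕ.+-identityʳ K) ⟨
  2 * K ∎
  where
  length-map-upTo : (f : ℕ → ℤ) → length (map f (upTo K)) ≡ K
  length-map-upTo f = trans (List.length-map f (upTo K)) (List.length-upTo K)

signedColours-unique : ∀ K → Unique (signedColours K)
signedColours-unique K = Unique.++⁺ (Unique.map⁺ (ℕ.suc-injective ∘ ℤ.+-injective) (Unique.upTo⁺ K))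
                                    (Unique.map⁺ ℤ.-[1+-injective (Unique.upTo⁺ K))
                                    positive≢negative
  where
  positive≢negative : ∀ {x} → ¬ (x ∈ map (λ j → + suc j) (upTo K) × x ∈ map -[1+_] (upTo K))
  positive≢negative (x∈pos , x∈neg) with ∈-map⁻ _ x∈pos | ∈-map⁻ _ x∈neg
  ... | _ , _ , refl | _ , _ , ()

∑-signedColours-neg : ∀ K (f : ℤ → ℕ) → ∑[ a ∈ signedColours K ] f (- a) ≡ ∑ (signedColours K) f
∑-signedColours-neg K f = begin
  ∑[ a ∈ positive ++ negative ] f (- a)
    ≡⟨ ∑-++ positive negative (f ∘ -_) ⟩
  (∑[ a ∈ positive ] f (- a)) + (∑[ a ∈ negative ] f (- a))
    ≡⟨ cong₂ _+_ (∑-map _ (upTo K) (f ∘ -_)) (∑-map -[1+_] (upTo K) (f ∘ -_)) ⟩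
  (∑[ j ∈ upTo K ] f -[1+ j ]) + (∑[ j ∈ upTo K ] f (+ suc j))
    ≡⟨ ℕ.+-comm (∑[ j ∈ upTo K ] f -[1+ j ]) _ ⟩
  (∑[ j ∈ upTo K ] f (+ suc j)) + (∑[ j ∈ upTo K ] f -[1+ j ])
    ≡⟨ cong₂ _+_ (∑-map _ (upTo K) f) (∑-map -[1+_] (upTo K) f) ⟨
  ∑ positive f + ∑ negative f
    ≡⟨ ∑-++ positive negative f ⟨
  ∑ (positive ++ negative) f ∎
  where
  positive negative : List ℤ
  positive = map (λ j → + suc j) (upTo K)
  negative = map -[1+_] (upTo K)

module _ (k : ℕ) where
  private
    C : List ℤ
    C = signedColours (suc k)
  open Colourings C

  -- Switching at u turns B^{uv}(m,l) into (B(m,l),σ_l); this counts the proper colourings of both.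
  switchedBookCount : ℕ → ℕ → ℕ
  switchedBookCount p l = ∑[ a ∈ C ] ∑[ b ∈ C ] distinct a b * pathColourings p false (- a) b ^ l

  zfCount-bookσ : ∀ m n l → l ≤ n →
    zfCount (bookσ m n l) (suc k) ≡ switchedBookCount (m ∸ 2) l * pathCount≢ (2 * k) (m ∸ 2) ^ (n ∸ l)
  zfCount-bookσ m n l l≤n = begin
    zfCount (bookσ m n l) (suc k)
      ≡⟨ properColourings-signedBook n p false (λ i → toℕ i <ᵇ l) ⟩
    ∑[ a ∈ C ] ∑[ b ∈ C ] distinct a b * ∏Fin n (λ i → Q (toℕ i <ᵇ l) a b)
      ≡⟨ ∑-cong-∈ C (λ a∈C → ∑-cong-∈ C (λ b∈C → pages a∈C b∈C)) ⟩
    ∑[ a ∈ C ] ∑[ b ∈ C ] distinct a b * Q false (- a) b ^ l * D ^ (n ∸ l)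
      ≡⟨ ∑-cong C (λ a → *-distribʳ-∑ (D ^ (n ∸ l)) C (λ b → distinct a b * Q false (- a) b ^ l)) ⟨
    ∑[ a ∈ C ] (∑[ b ∈ C ] distinct a b * Q false (- a) b ^ l) * D ^ (n ∸ l)
      ≡⟨ *-distribʳ-∑ (D ^ (n ∸ l)) C (λ a → ∑[ b ∈ C ] distinct a b * Q false (- a) b ^ l) ⟨
    switchedBookCount p l * D ^ (n ∸ l) ∎
    where
    p = m ∸ 2
    D = pathCount≢ (2 * k) p
    Q = pathColourings p
    pages : ∀ {a b} → a ∈ C → b ∈ C → distinct a b * ∏Fin n (λ i → Q (toℕ i <ᵇ l) a b)
                                        ≡ distinct a b * Q false (- a) b ^ l * D ^ (n ∸ l)
    pages {a} {b} a∈C b∈C = begin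
      distinct a b * ∏Fin n (λ i → Q (toℕ i <ᵇ l) a b)
        ≡⟨ cong (distinct a b *_) (∏Fin-threshold (λ s → Q s a b) n l l≤n) ⟩
      distinct a b * (Q true a b ^ l * Q false a b ^ (n ∸ l))
        ≡⟨ cong (λ x → distinct a b * (x ^ l * Q false a b ^ (n ∸ l))) (pathColourings-neg p a b) ⟩
      distinct a b * (Q false (- a) b ^ l * Q false a b ^ (n ∸ l))
        ≡⟨ distinct-*-cong _ (λ a≢b → cong (λ x → Q false (- a) b ^ l * x ^ (n ∸ l))
                                          (pathColourings-≢ (signedColours-unique (suc k)) length-C p a∈C b∈C a≢b)) ⟩
      distinct a b * (Q false (- a) b ^ l * D ^ (n ∸ l))
        ≡⟨ ℕ.*-assoc (distinct a b) _ _ ⟨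
      distinct a b * Q false (- a) b ^ l * D ^ (n ∸ l) ∎
      where
      length-C : length C ≡ 2 + 2 * k
      length-C = trans (length-signedColours (suc k)) (ℕ.*-suc 2 k)

  zfCount-bookUV : ∀ m l → zfCount (bookUV m l) (suc k) ≡ switchedBookCount (m ∸ 2) l
  zfCount-bookUV m l = begin
    zfCount (bookUV m l) (suc k)
      ≡⟨ properColourings-signedBook l p true (λ _ → false) ⟩
    ∑[ a ∈ C ] ∑[ b ∈ C ] distinct a (- b) * ∏Fin l (λ _ → Q a b)
      ≡⟨ ∑-cong C (λ a → ∑-cong C (λ b → cong (distinct a (- b) *_) (∏Fin-const l (Q a b)))) ⟩
    ∑[ a ∈ C ] ∑[ b ∈ C ] distinct a (- b) * Q a b ^ l
      ≡⟨ ∑-signedColours-neg (suc k) (λ a → ∑[ b ∈ C ] distinct a (- b) * Q a b ^ l) ⟨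
    ∑[ a ∈ C ] ∑[ b ∈ C ] distinct (- a) (- b) * Q (- a) b ^ l
      ≡⟨ ∑-cong C (λ a → ∑-cong C (λ b → cong (_* Q (- a) b ^ l) (distinct-neg a b))) ⟩
    switchedBookCount p l ∎
    where
    p = m ∸ 2
    Q = pathColourings p false

theorem4p7 : (m n l : ℕ) → 3 ≤ m → 2 ≤ n → 2 ≤ l → l ≤ n ∸ 1 →
    (k : ℕ) →
      + zfCount (bookσ m n l) (suc k)
        ≡ (γ m (+ (2 * suc k)) ^ℤ (n ∸ l)) *ℤ + zfCount (bookUV m l) (suc k)
theorem4p7 m n l 3≤m _ _ l≤n∸1 k = begin
  + zfCount (bookσ m n l) (suc k)
    ≡⟨ cong +_ (zfCount-bookσ k m n l l≤n) ⟩
  + (S * D ^ (n ∸ l))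
    ≡⟨ trans (cong +_ (ℕ.*-comm S _)) (ℤ.pos-* (D ^ (n ∸ l)) S) ⟩
  + (D ^ (n ∸ l)) *ℤ + S
    ≡⟨ cong₂ _*ℤ_ (trans (pos-^ D (n ∸ l)) (cong (_^ℤ (n ∸ l)) (sym γ≡D)))
                  (cong +_ (sym (zfCount-bookUV k m l))) ⟩
  γ m (+ (2 * suc k)) ^ℤ (n ∸ l) *ℤ + zfCount (bookUV m l) (suc k) ∎
  where
  S = switchedBookCount k (m ∸ 2) l
  D = pathCount≢ (2 * k) (m ∸ 2)
  l≤n = ℕ.≤-trans l≤n∸1 (ℕ.m∸n≤m n 1)
  γ≡D = γ-pathCount (2 * k) (ℕ.<⇒≤ 3≤m) (2 * suc k) (ℕ.*-suc 2 k)
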